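{- Let $G$ be a finite simple undirected graph with degeneracy $\alpha$, let $k\ge1$ be an integer, and consider any execution of the algorithm $\mathsf{kDC\text{ - }two}(G,k)$ described in the context. Fix an index $i$, let $f:=v_i$ and $g:=g_{v_i}$ be as in the algorithm, let $t$ be the number of non-neighbors of $f$ in $g$, and let $\mathcal{T}$ be the search tree of the call $\mathsf{BB}(g,\{f\})$, with root $I_0$. Let $\mathcal{L}$ be the set of nodes $I$ of $\mathcal{T}$ such that (a) the path from $I_0$ to $I$ has at most $t$ edges and at most $k$ edges going to a left child, (b) either $I$ is a leaf of $\mathcal{T}$, or this path has exactly $t$ edges, or it has exactly $k$ edges going to a left child, and (c) no proper ancestor of $I$ satisfies (b). Then every $I\in\mathcal{L}$ satisfies $|I|\le\alpha$ and $|V(I.g)|\le\alpha+k+1$.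
   Context: All graphs are finite, simple and undirected. For a graph $g$ and $X\subseteq V(g)$, a non-edge of $X$ is an unordered pair of distinct non-adjacent vertices of $X$; $\overline{E}_g(X)$ is the set of non-edges of $X$. For an integer $k\ge1$, $X$ is a $k$-defective clique of $g$ if $|\overline{E}_g(X)|\le k$. $d_g(u)$ is the degree of $u$ in $g$. A degeneracy ordering of $G$ ($n=|V(G)|$) is an ordering $(v_1,\dots,v_n)$ of $V(G)$ such that each $v_i$ has minimum degree in $G[\{v_i,\dots,v_n\}]$; the degeneracy $\alpha$ is the maximum over $i$ of the degree of $v_i$ in $G[\{v_i,\dots,v_n\}]$. For $A\subseteq V(G)$, $N[A]$ denotes $A$ together with all neighbors of vertices of $A$. Algorithm $\mathsf{kDC\text{ - }two}(G,k)$: set $C^*:=\emptyset$; compute a degeneracy ordering $(v_1,\dots,v_n)$; for each $i$: let $A:=N_G(v_i)\cap\{v_i,\dots,v_n\}$, let $g_{v_i}$ be the subgraph of $G$ induced by $N[A]\cap\{v_i,\dots,v_n\}$, and call $\mathsf{BB}(g_{v_i},\{v_i\})$. Afterwards, if $|C^*|<k+1$, call $\mathsf{BB}(G,\emptyset)$. Return $C^*$. Procedure $\mathsf{BB}(g,S)$ ($S\subseteq V(g)$): apply the following rules in arbitrary order until neither applies, obtaining $(g',S')$: (RR1) if some $u\in V(g)\setminus S$ has $|\overline{E}_g(S\cup\{u\})|>k$, delete $u$ from $g$; (RR2) if some $u\in V(g)\setminus S$ has $|\overline{E}_g(S\cup\{u\})|\le k$ and $d_g(u)\ge|V(g)|-2$,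 add $u$ to $S$. If $V(g')$ is a $k$-defective clique, set $C^*:=V(g')$ if $|V(g')|>|C^*|$ and return. Otherwise choose $b\in V(g')\setminus S'$ by rule (BR): a vertex of $V(g')\setminus S'$ with at least one non-neighbor in $S'$ if one exists, otherwise an arbitrary vertex of $V(g')\setminus S'$; then call $\mathsf{BB}(g',S'\cup\{b\})$ and $\mathsf{BB}(g'-b,S')$. Search tree: the call $\mathsf{BB}(g,\{f\})$ generates a recursion tree $\mathcal{T}$ whose nodes are the invocations of $\mathsf{BB}$; a non-leaf invocation has as left child the invocation $\mathsf{BB}(g',S'\cup\{b\})$ and as right child $\mathsf{BB}(g'-b,S')$; leaves are the invocations that return because $V(g')$ is a $k$-defective clique. For a node $I$ corresponding to $\mathsf{BB}(h,S)$, $I.g:=h'$ and $I.S:=S'$ (after applying RR1 and RR2), except that if $V(h')$ is a $k$-defective clique then $I.S:=V(h')$. The size of $I$ is $|I|:=|V(I.g)\setminus I.S|$. -}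

module Defs where

open import Data.Bool using (Bool; true; false; _∧_; _∨_; not; if_then_else_)
open import Data.Nat using (ℕ; zero; suc; _+_; _≤_; _<_; _⊔_; _≤ᵇ_; _<ᵇ_)
open import Data.Fin using (Fin; toℕ; _≟_)
open import Data.Fin.Subset using (Subset; _∈_; _∉_; _∩_; _∪_; _─_; _-_; ⁅_⁆; ∣_∣)
open import Data.Vec using (tabulate; lookup)
open import Data.List using (List; []; _∷_; allFin; map; foldr)
open import Data.Nat.ListAction using (sum)
open import Data.Bool.ListAction using (any)
open import Data.Maybe using (Maybe; just; nothing)
open import Data.Product using (_×_; _,_; Σ; ∃)
open import Data.Sum using (_⊎_)
open import Relation.Nullary using (¬_; does)
open import Relation.Binary.PropositionalEquality using (_≡_; _≢_)
open import Relation.Binary.Construct.Closure.ReflexiveTransitive using (Star)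
open import Function.Definitions using (Injective)

record Graph (n : ℕ) : Set where
  field
    adj   : Fin n → Fin n → Bool
    sym   : ∀ u v → adj u v ≡ adj v u
    irref : ∀ u → adj u u ≡ false
open Graph public

module _ {n : ℕ} (G : Graph n) where

  -- number of non-edges of X (unordered pairs {u,v}, u ≠ v, u,v ∈ X, non-adjacent);
  -- each unordered pair counted once via toℕ u < toℕ v
  nonEdges : Subset n → ℕ
  nonEdges X = sum (map (λ u → sum (map (λ v →
      if (toℕ u <ᵇ toℕ v) ∧ lookup X u ∧ lookup X v ∧ not (adj G u v) then 1 else 0)
      (allFin n))) (allFin n))

  IsKDC : ℕ → Subset n → Set
  IsKDC k X = nonEdges X ≤ k

  deg : Subset n → Fin n → ℕ
  deg V u = ∣ tabulate (λ w → lookup V w ∧ adj G u w) ∣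

  -- Degeneracy orderings.  ord i is the vertex at position i.

  later : (Fin n → Fin n) → Fin n → Subset n
  later ord i = tabulate (λ u → any (λ j → (toℕ i ≤ᵇ toℕ j) ∧ does (ord j ≟ u)) (allFin n))

  record IsDegeneracyOrdering (ord : Fin n → Fin n) : Set where
    field
      injective : Injective _≡_ _≡_ ord   -- hence a permutation of V(G)
      minDeg    : ∀ i u → u ∈ later ord i → deg (later ord i) (ord i) ≤ deg (later ord i) u
  open IsDegeneracyOrdering public

  degeneracy : (Fin n → Fin n) → ℕ
  degeneracy ord = foldr _⊔_ 0 (map (λ i → deg (later ord i) (ord i)) (allFin n))

  gVerts : (Fin n → Fin n) → Fin n → Subset n
  gVerts ord i = (NA ∪ ⁅ ord i ⁆) ∩ later ord i
    where
      A : Subset n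
      A = tabulate (λ u → adj G (ord i) u ∧ lookup (later ord i) u)
      NA : Subset n
      NA = tabulate (λ u → lookup A u ∨ any (λ w → lookup A w ∧ adj G w u) (allFin n))

  nonNbrs : Subset n → Fin n → ℕ
  nonNbrs V f = ∣ tabulate (λ u → lookup V u ∧ not (adj G f u) ∧ not (does (u ≟ f))) ∣

  -- Procedure BB.  All graphs occurring are induced subgraphs G[V], so a
  -- state (g, S) is represented by the pair (V(g), S).

  module _ (k : ℕ) where

    State : Set
    State = Subset n × Subset n

    data Step : State → State → Set where
      rr1 : ∀ {V S} u → u ∈ V → u ∉ S → k < nonEdges (S ∪ ⁅ u ⁆) →
            Step (V , S) (V - u , S)
      rr2 : ∀ {V S} u → u ∈ V → u ∉ S → nonEdges (S ∪ ⁅ u ⁆) ≤ k →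
            ∣ V ∣ ≤ deg V u + 2 →
            Step (V , S) (V , S ∪ ⁅ u ⁆)

    Irreducible : State → Set
    Irreducible x = ∀ y → ¬ Step x y

    BRChoice : Subset n → Subset n → Fin n → Set
    BRChoice V S b =
      (Σ (Fin n) λ s → s ∈ S × adj G b s ≡ false)
      ⊎ (∀ u → u ∈ V → u ∉ S → ∀ s → s ∈ S → adj G u s ≡ true)

    -- A possible execution (recursion tree) of BB(G[V], S).
    data BBTree (V S : Subset n) : Set where
      leaf : ∀ {V' S'} → Star Step (V , S) (V' , S') → Irreducible (V' , S') →
             IsKDC k V' → BBTree V S
      node : ∀ {V' S'} → Star Step (V , S) (V' , S') → Irreducible (V' , S') →
             ¬ IsKDC k V' →
             (b : Fin n) → b ∈ V' → b ∉ S' → BRChoice V' S' b →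
             BBTree V' (S' ∪ ⁅ b ⁆) →
             BBTree (V' - b) S' →
             BBTree V S

    -- Node data: (I.g as vertex set, I.S, is-leaf).  For a leaf I.S := V(I.g).
    NodeInfo : Set
    NodeInfo = Subset n × Subset n × Bool

    -- node reached from the root by a path; true = go to left child
    nodeAt : ∀ {V S} → BBTree V S → List Bool → Maybe NodeInfo
    nodeAt (leaf {V'} _ _ _) []            = just (V' , V' , true)
    nodeAt (leaf _ _ _)      (_ ∷ _)       = nothing
    nodeAt (node {V'} {S'} _ _ _ _ _ _ _ l r) [] = just (V' , S' , false)
    nodeAt (node _ _ _ _ _ _ _ l r) (true ∷ p)  = nodeAt l p
    nodeAt (node _ _ _ _ _ _ _ l r) (false ∷ p) = nodeAt r p

lefts : List Bool → ℕ
lefts []           = 0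
lefts (true ∷ p)   = suc (lefts p)
lefts (false ∷ p)  = lefts p

{-# OPTIONS --safe #-}
module Submission where

-- Along the path from the root (g, {f}) to a node (V, S) with l left branches among d branches,
-- every branch settles a vertex of V ∖ S and every right branch deletes one, so
-- |V ∖ S| + d < |V(g)| and |V| + d ≤ |V(g)| + l.  A left branch either creates a non-edge
-- inside S or, by (BR), happens when all of V ∖ S is adjacent to all of S; hence either
-- |Ē(S)| ≥ l or every vertex of V ∖ S is a neighbour of f.  As V(g) consists of f, its at most α
-- later neighbours and its t non-neighbours, depth t gives both bounds directly.  At a leaf, or
-- after k left branches, RR1 forces |Ē(S)| ≤ k and makes every vertex of V ∖ S a neighbour of f;
-- then V ∖ S lies among those α neighbours, and V among f, the neighbours and the at most k
-- non-neighbours of f in S.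

open import Defs hiding (sym)
open import Data.Nat using (ℕ; suc; _+_; _≤_; _<_; _⊔_; _≤ᵇ_; _<ᵇ_; z≤n; s≤s)
open import Data.Nat.Properties hiding (_≟_)
open import Algebra.Properties.CommutativeSemigroup +-commutativeSemigroup
  using (interchange; xy∙z≈xz∙y)
open import Data.Bool using (Bool; true; false; T; _∧_; not; if_then_else_)
open import Data.Bool.Properties using (T-∧; T-≡; T-not-≡)
open import Data.Fin using (Fin; toℕ; _≟_)
import Data.Fin as Fin
open import Data.Fin.Properties using (toℕ-injective)
open import Data.Fin.Subset
  using (Subset; inside; outside; _∈_; _∉_; _⊆_; _∪_; _─_; _-_; ⁅_⁆; ∣_∣)
open import Data.Fin.Subset.Properties
open import Data.Vec using ([]; _∷_; lookup; tabulate; here; there)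
open import Data.Vec.Properties using (lookup∘tabulate; []=⇒lookup; lookup⇒[]=)
open import Data.List using (List; []; _∷_; _++_; length; map; foldr; allFin)
open import Data.List.Properties using (map-tabulate)
open import Data.List.Membership.Propositional using () renaming (_∈_ to _∈ˡ_)
open import Data.List.Membership.Propositional.Properties using (∈-allFin)
open import Data.List.Relation.Unary.Any as Any using ()
open import Data.List.Relation.Unary.Any.Properties using (any⁺)
open import Data.Nat.ListAction using (sum)
open import Data.Maybe using (just)
open import Data.Product using (_×_; _,_; proj₁; proj₂; ∃)
import Data.Product as Product
open import Data.Sum using (_⊎_; inj₁; inj₂)
import Data.Sum as Sum
open import Function using (_∘_; id; Equivalence)
open Equivalence using (to; from)
open import Relation.Nullary using (¬_; Dec; does; yes; no; contradiction)
open import Relation.Nullary.Decidable using (dec-true)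
open import Relation.Binary.Definitions using (Tri; tri<; tri≈; tri>)
open import Relation.Binary.PropositionalEquality
  using (_≡_; _≢_; refl; sym; trans; cong; subst; subst₂)
open import Relation.Binary.Construct.Closure.ReflexiveTransitive using (Star; ε; _◅_)

module _ {a} {A : Set a} where

  sum-map-mono : ∀ {g h : A → ℕ} → (∀ x → g x ≤ h x) →
                 ∀ xs → sum (map g xs) ≤ sum (map h xs)
  sum-map-mono g≤h []       = z≤n
  sum-map-mono g≤h (x ∷ xs) = +-mono-≤ (g≤h x) (sum-map-mono g≤h xs)

  sum-map-mono-< : ∀ {g h : A → ℕ} {x xs} → (∀ y → g y ≤ h y) → x ∈ˡ xs → g x < h x →
                   sum (map g xs) < sum (map h xs)
  sum-map-mono-< {xs = _ ∷ xs} g≤h (Any.here refl) gx<hx = +-mono-<-≤ gx<hx (sum-map-mono g≤h xs)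
  sum-map-mono-< g≤h (Any.there x∈xs) gx<hx = +-mono-≤-< (g≤h _) (sum-map-mono-< g≤h x∈xs gx<hx)

  ≤-sum-map : ∀ (g : A → ℕ) {x xs} → x ∈ˡ xs → g x ≤ sum (map g xs)
  ≤-sum-map g (Any.here refl)  = m≤m+n _ _
  ≤-sum-map g (Any.there x∈xs) = ≤-trans (≤-sum-map g x∈xs) (m≤n+m _ _)

  sum-map-+ : ∀ (g h : A → ℕ) xs →
              sum (map (λ x → g x + h x) xs) ≡ sum (map g xs) + sum (map h xs)
  sum-map-+ g h []       = refl
  sum-map-+ g h (x ∷ xs) = trans (cong (g x + h x +_) (sum-map-+ g h xs))
                                 (interchange (g x) (h x) (sum (map g xs)) (sum (map h xs)))

  ≤-foldr-⊔ : ∀ (g : A → ℕ) {x xs} → x ∈ˡ xs → g x ≤ foldr _⊔_ 0 (map g xs)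
  ≤-foldr-⊔ g (Any.here refl)  = m≤m⊔n _ _
  ≤-foldr-⊔ g (Any.there x∈xs) = ≤-trans (≤-foldr-⊔ g x∈xs) (m≤n⊔m _ _)

∑ : ∀ {m} → (Fin m → ℕ) → ℕ
∑ g = sum (map g (allFin _))

∑-suc : ∀ {m} (g : Fin (suc m) → ℕ) → ∑ g ≡ g Fin.zero + ∑ (g ∘ Fin.suc)
∑-suc g = cong (λ xs → g Fin.zero + sum xs)
  (trans (map-tabulate Fin.suc g) (sym (map-tabulate id (g ∘ Fin.suc))))

module _ {m : ℕ} where

  ∈⇒T : ∀ {p : Subset m} {x} → x ∈ p → T (lookup p x)
  ∈⇒T x∈p = from T-≡ ([]=⇒lookup x∈p)

  T⇒∈ : ∀ {p : Subset m} {x} → T (lookup p x) → x ∈ p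
  T⇒∈ t = lookup⇒[]= _ _ (to T-≡ t)

  ∈-tabulate⁺ : ∀ {P : Fin m → Bool} {x} → T (P x) → x ∈ tabulate P
  ∈-tabulate⁺ {P} {x} t = T⇒∈ (subst T (sym (lookup∘tabulate P x)) t)

  ∈-tabulate⁻ : ∀ {P : Fin m → Bool} {x} → x ∈ tabulate P → T (P x)
  ∈-tabulate⁻ {P} {x} x∈ = subst T (lookup∘tabulate P x) (∈⇒T x∈)

x∈p─q⇒x∉q : ∀ {m} {x : Fin m} (p q : Subset m) → x ∈ p ─ q → x ∉ q
x∈p─q⇒x∉q (_ ∷ p) (outside ∷ q) (there x∈p─q) (there x∈q) = x∈p─q⇒x∉q p q x∈p─q x∈q
x∈p─q⇒x∉q (_ ∷ p) (inside  ∷ q) (there x∈p─q) (there x∈q) = x∈p─q⇒x∉q p q x∈p─q x∈q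

─-mono : ∀ {m} {p p′ q q′ : Subset m} → p′ ⊆ p → q ⊆ q′ → p′ ─ q′ ⊆ p ─ q
─-mono {p′ = p′} {q′ = q′} p′⊆p q⊆q′ x∈ =
  x∈p∧x∉q⇒x∈p─q (p′⊆p (p─q⊆p p′ q′ x∈)) (x∈p─q⇒x∉q p′ q′ x∈ ∘ q⊆q′)

p∪⁅x⁆⊆q : ∀ {m} {p q : Subset m} {x} → p ⊆ q → x ∈ q → p ∪ ⁅ x ⁆ ⊆ q
p∪⁅x⁆⊆q {p = p} {x = x} p⊆q x∈q y∈ with x∈p∪q⁻ p ⁅ x ⁆ y∈
... | inj₁ y∈p   = p⊆q y∈p
... | inj₂ y∈⁅x⁆ = subst (_∈ _) (sym (x∈⁅y⁆⇒x≡y x y∈⁅x⁆)) x∈q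

p⊆q-x : ∀ {m} {p q : Subset m} {x} → p ⊆ q → x ∉ p → p ⊆ q - x
p⊆q-x p⊆q x∉p y∈p = x∈p∧x≢y⇒x∈p-y (p⊆q y∈p) (λ { refl → x∉p y∈p })

∣p∪q∣≤∣p∣+∣q∣ : ∀ {m} (p q : Subset m) → ∣ p ∪ q ∣ ≤ ∣ p ∣ + ∣ q ∣
∣p∪q∣≤∣p∣+∣q∣ []            []            = z≤n
∣p∪q∣≤∣p∣+∣q∣ (inside  ∷ p) (inside  ∷ q) =
  s≤s (≤-trans (∣p∪q∣≤∣p∣+∣q∣ p q) (+-monoʳ-≤ ∣ p ∣ (n≤1+n ∣ q ∣)))
∣p∪q∣≤∣p∣+∣q∣ (inside  ∷ p) (outside ∷ q) = s≤s (∣p∪q∣≤∣p∣+∣q∣ p q)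
∣p∪q∣≤∣p∣+∣q∣ (outside ∷ p) (inside  ∷ q) =
  subst (suc ∣ p ∪ q ∣ ≤_) (sym (+-suc ∣ p ∣ ∣ q ∣)) (s≤s (∣p∪q∣≤∣p∣+∣q∣ p q))
∣p∪q∣≤∣p∣+∣q∣ (outside ∷ p) (outside ∷ q) = ∣p∪q∣≤∣p∣+∣q∣ p q

∣p∣≤∑ : ∀ {m} (p : Subset m) {h : Fin m → ℕ} → (∀ {x} → x ∈ p → 1 ≤ h x) → ∣ p ∣ ≤ ∑ h
∣p∣≤∑ []            _   = z≤n
∣p∣≤∑ (inside  ∷ p) {h} 1≤h = subst (suc ∣ p ∣ ≤_) (sym (∑-suc h))
  (+-mono-≤ (1≤h here) (∣p∣≤∑ p (1≤h ∘ there)))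
∣p∣≤∑ (outside ∷ p) {h} 1≤h = subst (∣ p ∣ ≤_) (sym (∑-suc h))
  (≤-trans (∣p∣≤∑ p (1≤h ∘ there)) (m≤n+m _ (h Fin.zero)))

𝟙 : Bool → ℕ
𝟙 b = if b then 1 else 0

𝟙-mono : ∀ {a b} → (T a → T b) → 𝟙 a ≤ 𝟙 b
𝟙-mono {false} _   = z≤n
𝟙-mono {true} {true}  _   = ≤-refl
𝟙-mono {true} {false} a⇒b = contradiction _ a⇒b

𝟙-pos : ∀ {a} → T a → 1 ≤ 𝟙 a
𝟙-pos {true} _ = ≤-refl

𝟙-< : ∀ {a b} → ¬ T a → T b → 𝟙 a < 𝟙 b
𝟙-< {false} {true} _ _ = ≤-refl
𝟙-< {true}         ¬a _ = contradiction _ ¬a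

𝟙-zero : ∀ {a} → ¬ T a → 𝟙 a ≡ 0
𝟙-zero {false} _  = refl
𝟙-zero {true}  ¬a = contradiction _ ¬a

T-not-does⁺ : ∀ {a} {A : Set a} (a? : Dec A) → ¬ A → T (not (does a?))
T-not-does⁺ (yes a) ¬a = ¬a a
T-not-does⁺ (no _)  _  = _

T-not-does⁻ : ∀ {a} {A : Set a} (a? : Dec A) → T (not (does a?)) → ¬ A
T-not-does⁻ (no ¬a) _ = ¬a

row+column≤∑∑ : ∀ {m} (M : Fin m → Fin m → ℕ) f → M f f ≡ 0 →
                ∑ (M f) + ∑ (λ u → M u f) ≤ ∑ (λ u → ∑ (M u))
row+column≤∑∑ M f Mff≡0 = begin
  ∑ (M f) + ∑ (λ u → M u f)  ≤⟨ +-monoˡ-≤ _ (subst (_≤ ∑ δ) δf≡row (≤-sum-map δ (∈-allFin f))) ⟩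
  ∑ δ + ∑ (λ u → M u f)      ≡⟨ sum-map-+ δ (λ u → M u f) (allFin _) ⟨
  ∑ (λ u → δ u + M u f)      ≤⟨ sum-map-mono δ+column≤row (allFin _) ⟩
  ∑ (λ u → ∑ (M u))          ∎
  where
  open ≤-Reasoning
  -- the row of f is charged to the diagonal entry of the column, which is empty
  δ : Fin _ → ℕ
  δ u = if does (u ≟ f) then ∑ (M f) else 0
  δf≡row : δ f ≡ ∑ (M f)
  δf≡row rewrite dec-true (f ≟ f) refl = refl
  δ+column≤row : ∀ u → δ u + M u f ≤ ∑ (M u)
  δ+column≤row u with u ≟ f
  ... | yes refl = ≤-reflexive (trans (cong (∑ (M u) +_) Mff≡0) (+-identityʳ _))
  ... | no _     = ≤-sum-map (M u) (∈-allFin f)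

module _ {n : ℕ} (G : Graph n) where

  neighbours : Subset n → Fin n → Subset n
  neighbours V u = tabulate (λ w → lookup V w ∧ adj G u w)

  nonNeighbours : Subset n → Fin n → Subset n
  nonNeighbours V u = tabulate (λ w → lookup V w ∧ not (adj G u w) ∧ not (does (w ≟ u)))

  ∈-neighbours⁺ : ∀ {V u v} → v ∈ V → adj G u v ≡ true → v ∈ neighbours V u
  ∈-neighbours⁺ v∈V uv∈E = ∈-tabulate⁺ (from T-∧ (∈⇒T v∈V , from T-≡ uv∈E))

  ∈-nonNeighbours⁺ : ∀ {V u v} → v ∈ V → adj G u v ≡ false → v ≢ u → v ∈ nonNeighbours V u
  ∈-nonNeighbours⁺ {u = u} {v} v∈V uv∉E v≢u =
    ∈-tabulate⁺ (from T-∧ (∈⇒T v∈V , from T-∧ (from T-not-≡ uv∉E , T-not-does⁺ (v ≟ u) v≢u)))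

  ∈-nonNeighbours⁻ : ∀ {V u v} → v ∈ nonNeighbours V u → v ∈ V × adj G u v ≡ false × v ≢ u
  ∈-nonNeighbours⁻ {u = u} {v} v∈ with to T-∧ (∈-tabulate⁻ v∈)
  ... | v∈V , t with to T-∧ t
  ...   | uv∉E , v≢u = T⇒∈ v∈V , to T-not-≡ uv∉E , T-not-does⁻ (v ≟ u) v≢u

  isNonEdgeᵇ : Subset n → Fin n → Fin n → Bool
  isNonEdgeᵇ X u v = (toℕ u <ᵇ toℕ v) ∧ lookup X u ∧ lookup X v ∧ not (adj G u v)

  OrderedNonEdge : Subset n → Fin n → Fin n → Set
  OrderedNonEdge X u v = toℕ u < toℕ v × u ∈ X × v ∈ X × adj G u v ≡ false

  isNonEdgeᵇ⁺ : ∀ {X u v} → OrderedNonEdge X u v → T (isNonEdgeᵇ X u v)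
  isNonEdgeᵇ⁺ (u<v , u∈X , v∈X , uv∉E) =
    from T-∧ (<⇒<ᵇ u<v , from T-∧ (∈⇒T u∈X , from T-∧ (∈⇒T v∈X , from T-not-≡ uv∉E)))

  isNonEdgeᵇ⁻ : ∀ {X u v} → T (isNonEdgeᵇ X u v) → OrderedNonEdge X u v
  isNonEdgeᵇ⁻ {u = u} {v} t with to T-∧ t
  ... | u<v , t₁ with to T-∧ t₁
  ...   | u∈X , t₂ with to T-∧ t₂
  ...     | v∈X , uv∉E = <ᵇ⇒< (toℕ u) (toℕ v) u<v , T⇒∈ u∈X , T⇒∈ v∈X , to T-not-≡ uv∉E

  OrderedNonEdge-mono : ∀ {X Y u v} → X ⊆ Y → OrderedNonEdge X u v → OrderedNonEdge Y u v
  OrderedNonEdge-mono X⊆Y (u<v , u∈X , v∈X , uv∉E) = u<v , X⊆Y u∈X , X⊆Y v∈X , uv∉E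

  private
    𝟙-nonEdge-mono : ∀ {X Y} → (∀ {u v} → OrderedNonEdge X u v → OrderedNonEdge Y u v) →
                     ∀ u v → 𝟙 (isNonEdgeᵇ X u v) ≤ 𝟙 (isNonEdgeᵇ Y u v)
    𝟙-nonEdge-mono {X} {Y} X⇒Y u v = 𝟙-mono (isNonEdgeᵇ⁺ {Y} ∘ X⇒Y ∘ isNonEdgeᵇ⁻ {X} {u} {v})

  nonEdges-mono-< : ∀ {X Y u v} → (∀ {u v} → OrderedNonEdge X u v → OrderedNonEdge Y u v) →
                    OrderedNonEdge Y u v → ¬ OrderedNonEdge X u v → nonEdges G X < nonEdges G Y
  nonEdges-mono-< {u = u} {v} X⇒Y uvY ¬uvX =
    sum-map-mono-< (λ w → sum-map-mono (𝟙-nonEdge-mono X⇒Y w) (allFin n)) (∈-allFin u)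
      (sum-map-mono-< (𝟙-nonEdge-mono X⇒Y u) (∈-allFin v)
        (𝟙-< (¬uvX ∘ isNonEdgeᵇ⁻) (isNonEdgeᵇ⁺ uvY)))

  nonEdges-mono : ∀ {X Y} → X ⊆ Y → nonEdges G X ≤ nonEdges G Y
  nonEdges-mono X⊆Y = sum-map-mono
    (λ u → sum-map-mono (𝟙-nonEdge-mono (OrderedNonEdge-mono X⊆Y) u) (allFin n)) (allFin n)

  nonEdges-<-∪⁅⁆ : ∀ {S b s} → b ∉ S → s ∈ S → adj G b s ≡ false →
                   nonEdges G S < nonEdges G (S ∪ ⁅ b ⁆)
  nonEdges-<-∪⁅⁆ {S} {b} {s} b∉S s∈S bs∉E = newNonEdge (<-cmp (toℕ b) (toℕ s))
    where
    S⊆S′ : S ⊆ S ∪ ⁅ b ⁆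
    S⊆S′ = p⊆p∪q ⁅ b ⁆
    b∈S′ : b ∈ S ∪ ⁅ b ⁆
    b∈S′ = q⊆p∪q S ⁅ b ⁆ (x∈⁅x⁆ b)
    newNonEdge : Tri (toℕ b < toℕ s) (toℕ b ≡ toℕ s) (toℕ s < toℕ b) →
                 nonEdges G S < nonEdges G (S ∪ ⁅ b ⁆)
    newNonEdge (tri< b<s _ _) = nonEdges-mono-< (OrderedNonEdge-mono S⊆S′)
      (b<s , b∈S′ , S⊆S′ s∈S , bs∉E) (b∉S ∘ proj₁ ∘ proj₂)
    newNonEdge (tri≈ _ b≡s _) = contradiction (subst (_∈ S) (toℕ-injective (sym b≡s)) s∈S) b∉S
    newNonEdge (tri> _ _ s<b) = nonEdges-mono-< (OrderedNonEdge-mono S⊆S′)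
      (s<b , S⊆S′ s∈S , b∈S′ , trans (Graph.sym G s b) bs∉E) (b∉S ∘ proj₁ ∘ proj₂ ∘ proj₂)

  nonNbrs≤nonEdges : ∀ {Y f} → f ∈ Y → nonNbrs G Y f ≤ nonEdges G Y
  nonNbrs≤nonEdges {Y} {f} f∈Y = begin
    ∣ nonNeighbours Y f ∣        ≤⟨ ∣p∣≤∑ (nonNeighbours Y f) nonEdgeWithF ⟩
    ∑ (λ v → e f v + e v f)     ≡⟨ sum-map-+ (e f) (λ v → e v f) (allFin n) ⟩
    ∑ (e f) + ∑ (λ v → e v f)   ≤⟨ row+column≤∑∑ e f noLoop ⟩
    ∑ (λ u → ∑ (e u))           ∎
    where
    open ≤-Reasoning
    e : Fin n → Fin n → ℕ
    e u v = 𝟙 (isNonEdgeᵇ Y u v)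
    noLoop : e f f ≡ 0
    noLoop = 𝟙-zero (<-irrefl refl ∘ proj₁ ∘ isNonEdgeᵇ⁻ {Y} {f} {f})
    nonEdgeWithF : ∀ {v} → v ∈ nonNeighbours Y f → 1 ≤ e f v + e v f
    nonEdgeWithF {v} v∈ with ∈-nonNeighbours⁻ v∈ | <-cmp (toℕ f) (toℕ v)
    ... | v∈Y , fv∉E , _ | tri< f<v _ _ =
      ≤-trans (𝟙-pos (isNonEdgeᵇ⁺ (f<v , f∈Y , v∈Y , fv∉E))) (m≤m+n _ _)
    ... | _ , _ , v≢f | tri≈ _ f≡v _ = contradiction (toℕ-injective (sym f≡v)) v≢f
    ... | v∈Y , fv∉E , _ | tri> _ _ v<f =
      ≤-trans (𝟙-pos (isNonEdgeᵇ⁺ (v<f , v∈Y , f∈Y , trans (Graph.sym G v f) fv∉E))) (m≤n+m _ _)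

  ∣Y∣≤1+deg+nonNbrs : ∀ {Y L Z f} → Y ⊆ L →
                      (∀ {u} → u ∈ Y → u ≢ f → adj G f u ≡ false → u ∈ Z) →
                      ∣ Y ∣ ≤ suc (deg G L f + nonNbrs G Z f)
  ∣Y∣≤1+deg+nonNbrs {Y} {L} {Z} {f} Y⊆L nonNeighbour∈Z = begin
    ∣ Y ∣                         ≤⟨ p⊆q⇒∣p∣≤∣q∣ trichotomy ⟩
    ∣ ⁅ f ⁆ ∪ (N ∪ N̄) ∣           ≤⟨ ∣p∪q∣≤∣p∣+∣q∣ ⁅ f ⁆ (N ∪ N̄) ⟩
    ∣ ⁅ f ⁆ ∣ + ∣ N ∪ N̄ ∣         ≡⟨ cong (_+ ∣ N ∪ N̄ ∣) (∣⁅x⁆∣≡1 f) ⟩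
    suc ∣ N ∪ N̄ ∣                 ≤⟨ s≤s (∣p∪q∣≤∣p∣+∣q∣ N N̄) ⟩
    suc (∣ N ∣ + ∣ N̄ ∣)           ∎
    where
    open ≤-Reasoning
    N N̄ : Subset n
    N = neighbours L f
    N̄ = nonNeighbours Z f
    trichotomy : Y ⊆ ⁅ f ⁆ ∪ (N ∪ N̄)
    trichotomy {u} u∈Y with u ≟ f | adj G f u in fu
    ... | yes refl | _     = x∈p∪q⁺ (inj₁ (x∈⁅x⁆ u))
    ... | no u≢f   | true  = x∈p∪q⁺ (inj₂ (x∈p∪q⁺ (inj₁ (∈-neighbours⁺ (Y⊆L u∈Y) fu))))
    ... | no u≢f   | false =
      x∈p∪q⁺ (inj₂ (x∈p∪q⁺ (inj₂ (∈-nonNeighbours⁺ (nonNeighbour∈Z u∈Y u≢f fu) fu u≢f))))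

module _ {n : ℕ} (G : Graph n) (ord : Fin n → Fin n) (i : Fin n) where

  ord∈later : ord i ∈ later G ord i
  ord∈later = ∈-tabulate⁺ (any⁺ _ (Any.map (λ { refl → atI }) (∈-allFin i)))
    where
    atI : T ((toℕ i ≤ᵇ toℕ i) ∧ does (ord i ≟ ord i))
    atI = from T-∧ (≤⇒≤ᵇ (≤-refl {toℕ i}) , from T-≡ (dec-true (ord i ≟ ord i) refl))

  deg≤degeneracy : deg G (later G ord i) (ord i) ≤ degeneracy G ord
  deg≤degeneracy = ≤-foldr-⊔ (λ j → deg G (later G ord j) (ord j)) (∈-allFin i)

  gVerts⊆later : gVerts G ord i ⊆ later G ord i
  gVerts⊆later = p∩q⊆q _ _

  ord∈gVerts : ord i ∈ gVerts G ord i
  ord∈gVerts = x∈p∩q⁺ (x∈p∪q⁺ (inj₂ (x∈⁅x⁆ (ord i))) , ord∈later)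

module SearchTree {n : ℕ} (G : Graph n) (k : ℕ) (f : Fin n) (U : Subset n) where

  AdjacentToF : Subset n → Set
  AdjacentToF X = ∀ {u} → u ∈ X → adj G f u ≡ true

  -- l counts the left branches and d all branches on the path from the root (U, ⁅ f ⁆).
  record Invariant (V S : Subset n) (l d : ℕ) : Set where
    field
      V⊆U          : V ⊆ U
      S⊆V          : S ⊆ V
      f∈S          : f ∈ S
      undecided    : ∣ V ─ S ∣ + d < ∣ U ∣
      deleted      : ∣ V ∣ + d ≤ ∣ U ∣ + l
      leftBranches : AdjacentToF (V ─ S) ⊎ l ≤ nonEdges G S

  open Invariant

  InvariantAt : ℕ → ℕ → State G k → Set
  InvariantAt l d (V , S) = Invariant V S l d

  initial : f ∈ U → Invariant U ⁅ f ⁆ 0 0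
  initial f∈U = record
    { V⊆U          = id
    ; S⊆V          = λ x∈⁅f⁆ → subst (_∈ U) (sym (x∈⁅y⁆⇒x≡y f x∈⁅f⁆)) f∈U
    ; f∈S          = x∈⁅x⁆ f
    ; undecided    = subst (_< ∣ U ∣) (sym (+-identityʳ _)) (x∈p⇒∣p-x∣<∣p∣ f∈U)
    ; deleted      = ≤-refl
    ; leftBranches = inj₂ z≤n
    }

  shrink : ∀ {V S V′ S′ l d} → Invariant V S l d → V′ ⊆ V → S ⊆ S′ → S′ ⊆ V′ → Invariant V′ S′ l d
  shrink {d = d} inv V′⊆V S⊆S′ S′⊆V′ = record
    { V⊆U          = V⊆U inv ∘ V′⊆V
    ; S⊆V          = S′⊆V′
    ; f∈S          = S⊆S′ (f∈S inv)
    ; undecided    = ≤-<-trans (+-monoˡ-≤ d (p⊆q⇒∣p∣≤∣q∣ (─-mono V′⊆V S⊆S′))) (undecided inv)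
    ; deleted      = ≤-trans (+-monoˡ-≤ d (p⊆q⇒∣p∣≤∣q∣ V′⊆V)) (deleted inv)
    ; leftBranches = Sum.map (λ adjF u∈ → adjF (─-mono V′⊆V S⊆S′ u∈))
                             (λ l≤ → ≤-trans l≤ (nonEdges-mono G S⊆S′))
                             (leftBranches inv)
    }

  reduction-preserves : ∀ {l d x y} → Step G k x y → InvariantAt l d x → InvariantAt l d y
  reduction-preserves (rr1 {V} u _ u∉S _) inv = shrink inv (p─q⊆p V ⁅ u ⁆) id (p⊆q-x (S⊆V inv) u∉S)
  reduction-preserves (rr2 u u∈V _ _ _) inv = shrink inv id (p⊆p∪q ⁅ u ⁆) (p∪⁅x⁆⊆q (S⊆V inv) u∈V)

  reductions-preserve : ∀ {l d x y} → Star (Step G k) x y → InvariantAt l d x → InvariantAt l d y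
  reductions-preserve ε        inv = inv
  reductions-preserve (s ◅ ss) inv = reductions-preserve ss (reduction-preserves s inv)

  branch-left : ∀ {V S l d b} → Invariant V S l d → b ∈ V → b ∉ S → BRChoice G k V S b →
                Invariant V (S ∪ ⁅ b ⁆) (suc l) (suc d)
  branch-left {V} {S} {l} {d} {b} inv b∈V b∉S choice = record
    { V⊆U          = V⊆U inv
    ; S⊆V          = p∪⁅x⁆⊆q (S⊆V inv) b∈V
    ; f∈S          = S⊆S′ (f∈S inv)
    ; undecided    = subst (_< ∣ U ∣) (sym (+-suc _ d))
                       (≤-<-trans (+-monoˡ-< d settled) (undecided inv))
    ; deleted      = subst₂ _≤_ (sym (+-suc _ d)) (sym (+-suc _ l)) (s≤s (deleted inv))
    ; leftBranches = newLeftBranch choice (leftBranches inv)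
    }
    where
    S⊆S′ : S ⊆ S ∪ ⁅ b ⁆
    S⊆S′ = p⊆p∪q ⁅ b ⁆
    b∈S′ : b ∈ S ∪ ⁅ b ⁆
    b∈S′ = q⊆p∪q S ⁅ b ⁆ (x∈⁅x⁆ b)
    settled : ∣ V ─ (S ∪ ⁅ b ⁆) ∣ < ∣ V ─ S ∣
    settled = p⊂q⇒∣p∣<∣q∣ (─-mono id S⊆S′ , b , x∈p∧x∉q⇒x∈p─q b∈V b∉S ,
                            λ b∈ → x∈p─q⇒x∉q V _ b∈ b∈S′)
    newLeftBranch : BRChoice G k V S b → AdjacentToF (V ─ S) ⊎ l ≤ nonEdges G S →
                    AdjacentToF (V ─ (S ∪ ⁅ b ⁆)) ⊎ suc l ≤ nonEdges G (S ∪ ⁅ b ⁆)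
    newLeftBranch _ (inj₁ adjF) = inj₁ (λ u∈ → adjF (─-mono id S⊆S′ u∈))
    newLeftBranch (inj₁ (s , s∈S , bs∉E)) (inj₂ l≤) =
      inj₂ (≤-<-trans l≤ (nonEdges-<-∪⁅⁆ G b∉S s∈S bs∉E))
    newLeftBranch (inj₂ complete) (inj₂ _) = inj₁ λ {u} u∈ →
      let u∈V─S = ─-mono id S⊆S′ u∈ in
      trans (Graph.sym G f u)
        (complete u (p─q⊆p V S u∈V─S) (x∈p─q⇒x∉q V S u∈V─S) f (f∈S inv))

  branch-right : ∀ {V S l d b} → Invariant V S l d → b ∈ V → b ∉ S → Invariant (V - b) S l (suc d)
  branch-right {V} {S} {l} {d} {b} inv b∈V b∉S = record
    { V⊆U          = V⊆U inv ∘ p─q⊆p V ⁅ b ⁆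
    ; S⊆V          = p⊆q-x (S⊆V inv) b∉S
    ; f∈S          = f∈S inv
    ; undecided    = subst (_< ∣ U ∣) (sym (+-suc _ d))
                       (≤-<-trans (+-monoˡ-< d settled) (undecided inv))
    ; deleted      = subst (_≤ ∣ U ∣ + l) (sym (+-suc _ d))
                       (≤-trans (+-monoˡ-< d (x∈p⇒∣p-x∣<∣p∣ b∈V)) (deleted inv))
    ; leftBranches = Sum.map (λ adjF u∈ → adjF (─-mono (p─q⊆p V ⁅ b ⁆) id u∈)) id (leftBranches inv)
    }
    where
    settled : ∣ (V - b) ─ S ∣ < ∣ V ─ S ∣
    settled = p⊂q⇒∣p∣<∣q∣ (─-mono (p─q⊆p V ⁅ b ⁆) id , b , x∈p∧x∉q⇒x∈p─q b∈V b∉S ,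
                            λ b∈ → x∈p─q⇒x∉q V ⁅ b ⁆ (p─q⊆p (V - b) S b∈) (x∈⁅x⁆ b))

  NodeFacts : Subset n → Subset n → Bool → Set
  NodeFacts V S true  = S ≡ V × IsKDC G k V
  NodeFacts V S false = Irreducible G k (V , S) × ∃ λ b → b ∈ V × b ∉ S

  reach : ∀ {V S l d} (T : BBTree G k V S) p {V′ S′ isLeaf} →
          nodeAt G k T p ≡ just (V′ , S′ , isLeaf) → Invariant V S l d →
          Invariant V′ S′ (lefts p + l) (length p + d) × NodeFacts V′ S′ isLeaf
  reach {l = l} {d} (leaf {V′} {S′} reductions _ isKDC) [] refl inv =
    shrink inv′ id (S⊆V inv′) id , refl , isKDC
    where
    inv′ : Invariant V′ S′ l d
    inv′ = reductions-preserve reductions inv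
  reach (node reductions irreducible _ b b∈V b∉S _ _ _) [] refl inv =
    reductions-preserve reductions inv , irreducible , b , b∈V , b∉S
  reach {l = l} {d} (node reductions _ _ b b∈V b∉S choice left _) (true ∷ p) at inv =
    Product.map₁ (subst₂ (Invariant _ _) (+-suc (lefts p) l) (+-suc (length p) d))
      (reach left p at (branch-left (reductions-preserve reductions inv) b∈V b∉S choice))
  reach {d = d} (node reductions _ _ b b∈V b∉S _ _ right) (false ∷ p) at inv =
    Product.map₁ (subst (Invariant _ _ _) (+-suc (length p) d))
      (reach right p at (branch-right (reductions-preserve reductions inv) b∈V b∉S))

  Bounded : ℕ → Subset n → Subset n → Set
  Bounded δ V S = ∣ V ─ S ∣ ≤ δ × ∣ V ∣ ≤ δ + k + 1

  Bounded-mono : ∀ {δ δ′ V S} → δ ≤ δ′ → Bounded δ V S → Bounded δ′ V S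
  Bounded-mono δ≤δ′ (undecided≤ , size≤) =
    ≤-trans undecided≤ δ≤δ′ , ≤-trans size≤ (+-monoˡ-≤ 1 (+-monoˡ-≤ k δ≤δ′))

  Saturated : Subset n → Subset n → Set
  Saturated V S = AdjacentToF (V ─ S) × nonEdges G S ≤ k

  irreducible⇒nonEdges≤k : ∀ {V S u} → Irreducible G k (V , S) → u ∈ V → u ∉ S →
                           nonEdges G (S ∪ ⁅ u ⁆) ≤ k
  irreducible⇒nonEdges≤k irreducible u∈V u∉S = ≮⇒≥ (λ k< → irreducible _ (rr1 _ u∈V u∉S k<))

  leaf-saturated : ∀ {V} → IsKDC G k V → Saturated V V
  leaf-saturated {V} isKDC = (λ u∈ → contradiction (p─q⊆p V V u∈) (x∈p─q⇒x∉q V V u∈)) , isKDC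

  inner-saturated : ∀ {V S d b} → Invariant V S k d → Irreducible G k (V , S) → b ∈ V → b ∉ S →
                    Saturated V S
  inner-saturated {V} {S} {b = b} inv irreducible b∈V b∉S =
    adjacentToF (leftBranches inv) ,
    ≤-trans (nonEdges-mono G (p⊆p∪q {p = S} ⁅ b ⁆)) (irreducible⇒nonEdges≤k irreducible b∈V b∉S)
    where
    adjacentToF : AdjacentToF (V ─ S) ⊎ k ≤ nonEdges G S → AdjacentToF (V ─ S)
    adjacentToF (inj₁ adjF) = adjF
    adjacentToF (inj₂ k≤) {u} u∈ with adj G f u in fu
    ... | true  = refl
    ... | false = contradiction
      (irreducible⇒nonEdges≤k irreducible (p─q⊆p V S u∈) (x∈p─q⇒x∉q V S u∈))
      (<⇒≱ (≤-<-trans k≤ (nonEdges-<-∪⁅⁆ G (x∈p─q⇒x∉q V S u∈) (f∈S inv)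
                                          (trans (Graph.sym G u f) fu))))

  saturated-bounds : ∀ {L V S l d} → U ⊆ L → Invariant V S l d → Saturated V S →
                     Bounded (deg G L f) V S
  saturated-bounds {L} {V} {S} U⊆L inv (adjF , nonEdges≤k) =
    p⊆q⇒∣p∣≤∣q∣ (λ u∈ → ∈-neighbours⁺ G (U⊆L (V⊆U inv (p─q⊆p V S u∈))) (adjF u∈)) ,
    (begin
      ∣ V ∣                              ≤⟨ ∣Y∣≤1+deg+nonNbrs G (U⊆L ∘ V⊆U inv) nonNeighbour∈S ⟩
      suc (deg G L f + nonNbrs G S f)    ≤⟨ s≤s (+-monoʳ-≤ _ nonNbrs≤k) ⟩
      suc (deg G L f + k)                ≡⟨ +-comm 1 _ ⟩
      deg G L f + k + 1                  ∎)
    where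
    open ≤-Reasoning
    nonNbrs≤k : nonNbrs G S f ≤ k
    nonNbrs≤k = ≤-trans (nonNbrs≤nonEdges G (f∈S inv)) nonEdges≤k
    nonNeighbour∈S : ∀ {u} → u ∈ V → u ≢ f → adj G f u ≡ false → u ∈ S
    nonNeighbour∈S {u} u∈V _ fu∉E with u ∈? S
    ... | yes u∈S = u∈S
    ... | no  u∉S = contradiction (trans (sym fu∉E) (adjF (x∈p∧x∉q⇒x∈p─q u∈V u∉S))) λ ()

  depth-bounds : ∀ {L V S l} → U ⊆ L → Invariant V S l (nonNbrs G U f) → l ≤ k →
                 Bounded (deg G L f) V S
  depth-bounds {L} {V} {S} {l} U⊆L inv l≤k =
    +-cancelʳ-≤ t _ _ (m<1+n⇒m≤n (<-≤-trans (undecided inv) ∣U∣≤)) ,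
    (begin
      ∣ V ∣          ≤⟨ +-cancelʳ-≤ t _ _ ∣V∣+t≤ ⟩
      suc (δ + l)    ≤⟨ s≤s (+-monoʳ-≤ δ l≤k) ⟩
      suc (δ + k)    ≡⟨ +-comm 1 _ ⟩
      δ + k + 1      ∎)
    where
    open ≤-Reasoning
    t δ : ℕ
    t = nonNbrs G U f
    δ = deg G L f
    ∣U∣≤ : ∣ U ∣ ≤ suc (δ + t)
    ∣U∣≤ = ∣Y∣≤1+deg+nonNbrs G U⊆L (λ u∈U _ _ → u∈U)
    ∣V∣+t≤ : ∣ V ∣ + t ≤ suc (δ + l) + t
    ∣V∣+t≤ = begin
      ∣ V ∣ + t        ≤⟨ deleted inv ⟩
      ∣ U ∣ + l        ≤⟨ +-monoˡ-≤ l ∣U∣≤ ⟩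
      suc (δ + t) + l  ≡⟨ cong suc (xy∙z≈xz∙y δ t l) ⟩
      suc (δ + l) + t  ∎

  node-bounds : ∀ {L V S l d isLeaf} → U ⊆ L → Invariant V S l d → NodeFacts V S isLeaf → l ≤ k →
                isLeaf ≡ true ⊎ d ≡ nonNbrs G U f ⊎ l ≡ k → Bounded (deg G L f) V S
  node-bounds {isLeaf = true} U⊆L inv (refl , isKDC) _ _ =
    saturated-bounds U⊆L inv (leaf-saturated isKDC)
  node-bounds {isLeaf = false} U⊆L inv _ l≤k (inj₂ (inj₁ refl)) = depth-bounds U⊆L inv l≤k
  node-bounds {isLeaf = false} U⊆L inv (irreducible , _ , b∈V , b∉S) _ (inj₂ (inj₂ refl)) =
    saturated-bounds U⊆L inv (inner-saturated inv irreducible b∈V b∉S)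

mainTheorem7 : ∀ {n} (G : Graph n) (k : ℕ) → 1 ≤ k →
    (ord : Fin n → Fin n) → IsDegeneracyOrdering G ord →
    (i : Fin n) →
    (T : BBTree G k (gVerts G ord i) ⁅ ord i ⁆) →
    (p : List Bool) (V S : Subset n) (isLeaf : Bool) →
    nodeAt G k T p ≡ just (V , S , isLeaf) →
    -- (a)
    length p ≤ nonNbrs G (gVerts G ord i) (ord i) → lefts p ≤ k →
    -- (b)
    (isLeaf ≡ true ⊎ length p ≡ nonNbrs G (gVerts G ord i) (ord i) ⊎ lefts p ≡ k) →
    -- (c) no proper ancestor satisfies (b)
    (∀ q r V′ S′ isLeaf′ → q ++ r ≡ p → r ≢ [] →
      nodeAt G k T q ≡ just (V′ , S′ , isLeaf′) →
      ¬ (isLeaf′ ≡ true ⊎ length q ≡ nonNbrs G (gVerts G ord i) (ord i) ⊎ lefts q ≡ k)) →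
    ∣ V ─ S ∣ ≤ degeneracy G ord × ∣ V ∣ ≤ degeneracy G ord + k + 1
mainTheorem7 G k _ ord _ i T p V S isLeaf at _ lefts≤k stop _ =
  Bounded-mono {V = V} {S} (deg≤degeneracy G ord i)
    (node-bounds (gVerts⊆later G ord i) inv facts lefts≤k stop)
  where
  open SearchTree G k (ord i) (gVerts G ord i)
  reached : Invariant V S (lefts p + 0) (length p + 0) × NodeFacts V S isLeaf
  reached = reach T p at (initial (ord∈gVerts G ord i))
  inv : Invariant V S (lefts p) (length p)
  inv = subst₂ (Invariant V S) (+-identityʳ _) (+-identityʳ _) (proj₁ reached)
  facts : NodeFacts V S isLeaf
  facts = proj₂ reached
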